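{- The subword patterns $1213$ and $1223$ are in the same strong Wilf class: for all $k\ge1$, $n\ge0$, $r\ge0$, the number of words in $[k]^n$ containing $1213$ exactly $r$ times equals the number containing $1223$ exactly $r$ times.
   Context: $[k]^n$ is the set of words of length $n$ over $\{1,\dots,k\}$. An occurrence of a subword pattern $\tau$ of length $l$ in $\sigma=\sigma_1\cdots\sigma_n$ is an index $i$ such that the consecutive factor $\sigma_i\cdots\sigma_{i+l-1}$ is order-isomorphic to $\tau$ (same relative order and same equalities among positions); "containing exactly $r$ times" means having exactly $r$ occurrences. -}

module Defs where

open import Data.Nat using (ℕ; zero; suc; _+_; _<_; _≟_; _<?_; compare; Ordering)
open import Data.Nat.Properties using (<-cmp)
open import Data.List using (List; []; _∷_; length; map; concatMap; filter; drop; take; allFin; upTo; lookup)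
open import Data.List.Relation.Unary.All using (All)
open import Data.List.Relation.Unary.All using () renaming (all? to all?)
open import Data.Fin using (Fin; toℕ)
open import Data.Bool using (Bool; true; false)
open import Relation.Nullary using (Dec; yes; no)
open import Relation.Nullary.Decidable using (⌊_⌋)
open import Relation.Binary.PropositionalEquality using (_≡_)
open import Relation.Binary.Definitions using (Tri; tri<; tri≈; tri>)

-- A word over [k] = {1,…,k} of length n is represented as a list of
-- natural numbers of length n with entries in {1,…,k}.

letters : ℕ → List ℕ
letters k = map suc (upTo k)

words : ℕ → ℕ → List (List ℕ)
words k zero    = [] ∷ []
words k (suc n) = concatMap (λ a → map (a ∷_) (words k n)) (letters k)

data Cmp : Set where
  LT EQ GT : Cmp

cmp : ℕ → ℕ → Cmp
cmp a b with <-cmp a b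
... | tri< _ _ _ = LT
... | tri≈ _ _ _ = EQ
... | tri> _ _ _ = GT

cmp-eq : (c d : Cmp) → Bool
cmp-eq LT LT = true
cmp-eq EQ EQ = true
cmp-eq GT GT = true
cmp-eq _  _  = false

and : List Bool → Bool
and []       = true
and (b ∷ bs) = Data.Bool._∧_ b (and bs)

orderIso : List ℕ → List ℕ → Bool
orderIso u v with length u ≟ length v
... | no  _ = false
... | yes _ = and (concatMap (λ i → map (λ j →
                  cmp-eq (cmp (nth u i) (nth u j)) (cmp (nth v i) (nth v j)))
                  (upTo (length u))) (upTo (length u)))
  where
  nth : List ℕ → ℕ → ℕ
  nth []       _       = 0
  nth (x ∷ xs) zero    = x
  nth (x ∷ xs) (suc i) = nth xs i

-- Number of occurrences of the subword pattern τ in σ: number of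
-- indices i (0-based) such that the consecutive factor
-- σ_i ⋯ σ_{i+|τ|-1} (lying entirely inside σ) is order-isomorphic to τ.
occurrences : List ℕ → List ℕ → ℕ
occurrences τ σ = length (filter (λ i → Data.Bool._≟_ (orderIso (take (length τ) (drop i σ)) τ) true)
                                 (upTo (length σ)))

countExactly : List ℕ → ℕ → ℕ → ℕ → ℕ
countExactly τ k n r = length (filter (λ σ → occurrences τ σ ≟ r) (words k n))

{-# OPTIONS --safe #-}

-- Call a set S of positions of a word a 1213-marking of it if an occurrence of
-- 1213 starts at every position of S. Summing, over all S of size m, the number of
-- words in [k]^n that S marks gives the binomial moment Σ_w C(occ(w), m), and these
-- moments determine the distribution of occ, because C(j, m) vanishes for j < m
-- and equals 1 for j = m. It therefore suffices to match, for each fixed S, the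
-- words marked by S for 1213 with those marked by S for 1223. Reading a word from
-- the left, replace the letter at position i + 2, for every i ∈ S, by its image under
-- the transposition of the original letters at positions i and i + 1. This turns
-- each marked factor a b a d into a b b d. Since every step permutes the alphabet
-- in a way that depends only on earlier letters, the map is a bijection of [k]^n.
-- It preserves the markings because neither pattern can overlap itself at distance
-- one.

module Submission where

open import Defs
open import Data.Bool using (Bool; true; false; T; if_then_else_)
import Data.Bool as Bool
open import Data.Empty using (⊥; ⊥-elim)
open import Data.List
  using (List; []; _∷_; _++_; map; concatMap; filter; length; take; drop; upTo; applyUpTo; downFrom)
open import Data.List.Membership.Propositional using (_∈_)
open import Data.List.Properties using (map-applyUpTo)
open import Data.List.Relation.Unary.All as All using (All; []; _∷_)
open import Data.List.Relation.Unary.All.Properties using (concat⁺; map⁺)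
open import Data.List.Relation.Unary.Any using (here; there)
open import Data.List.Relation.Unary.Unique.Propositional using (Unique; []; _∷_)
import Data.List.Relation.Unary.Unique.Propositional.Properties as Unique
open import Data.Nat using (ℕ; zero; suc; _+_; _*_; _≤_; _<_; _≥_; _≟_; z≤n; s≤s; s≤s⁻¹)
open import Data.Nat.Combinatorics using (_C_; nCn≡1; k>n⇒nCk≡0; nCk+nC[k+1]≡[n+1]C[k+1])
open import Data.Nat.Properties
open import Data.Nat.Tactic.RingSolver using (solve-∀)
open import Algebra.Properties.CommutativeSemigroup +-commutativeSemigroup using (interchange)
open import Data.Product using (_×_; _,_)
open import Data.Sum using (_⊎_; inj₁; inj₂)
open import Data.Unit using (⊤; tt)
open import Function using (id; _∘_; _⇔_; mk⇔; Equivalence)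
open import Relation.Binary.Definitions using (tri<; tri≈; tri>)
open import Relation.Binary.PropositionalEquality
open import Relation.Nullary using (Dec; yes; no; does; ¬_; _×-dec_; _→-dec_; T?)
open import Relation.Nullary.Decidable using (dec-true; dec-false; does-⇔)
open import Relation.Unary using (Decidable)

open ≡-Reasoning

private
  variable
    A B : Set

∑ : List A → (A → ℕ) → ℕ
∑ []       f = 0
∑ (x ∷ xs) f = f x + ∑ xs f
infix 5 ∑
syntax ∑ xs (λ x → e) = ∑[ x ∈ xs ] e

∑-cong : ∀ xs {f g : A → ℕ} → (∀ {x} → x ∈ xs → f x ≡ g x) → ∑ xs f ≡ ∑ xs g
∑-cong []       eq = refl
∑-cong (x ∷ xs) eq = cong₂ _+_ (eq (here refl)) (∑-cong xs (eq ∘ there))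

∑-zero : ∀ (xs : List A) → ∑[ x ∈ xs ] 0 ≡ 0
∑-zero []       = refl
∑-zero (x ∷ xs) = ∑-zero xs

∑-++ : ∀ xs ys (f : A → ℕ) → ∑ (xs ++ ys) f ≡ ∑ xs f + ∑ ys f
∑-++ []       ys f = refl
∑-++ (x ∷ xs) ys f = trans (cong (f x +_) (∑-++ xs ys f)) (sym (+-assoc (f x) _ _))

∑-map : ∀ (g : A → B) xs (f : B → ℕ) → ∑ (map g xs) f ≡ ∑[ x ∈ xs ] f (g x)
∑-map g []       f = refl
∑-map g (x ∷ xs) f = cong (f (g x) +_) (∑-map g xs f)

∑-concatMap : ∀ (g : A → List B) xs (f : B → ℕ) → ∑ (concatMap g xs) f ≡ ∑[ x ∈ xs ] ∑ (g x) f
∑-concatMap g []       f = refl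
∑-concatMap g (x ∷ xs) f = trans (∑-++ (g x) _ f) (cong (∑ (g x) f +_) (∑-concatMap g xs f))

∑-+ : ∀ xs (f g : A → ℕ) → ∑[ x ∈ xs ] (f x + g x) ≡ ∑ xs f + ∑ xs g
∑-+ []       f g = refl
∑-+ (x ∷ xs) f g = trans (cong (f x + g x +_) (∑-+ xs f g)) (interchange (f x) (g x) _ _)

∑-*ˡ : ∀ c xs (f : A → ℕ) → ∑[ x ∈ xs ] c * f x ≡ c * ∑ xs f
∑-*ˡ c []       f = sym (*-zeroʳ c)
∑-*ˡ c (x ∷ xs) f = trans (cong (c * f x +_) (∑-*ˡ c xs f)) (sym (*-distribˡ-+ c (f x) _))

∑-*ʳ : ∀ c xs (f : A → ℕ) → ∑[ x ∈ xs ] f x * c ≡ ∑ xs f * c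
∑-*ʳ c xs f = trans (∑-cong xs (λ {x} _ → *-comm (f x) c)) (trans (∑-*ˡ c xs f) (*-comm c _))

∑-swap : ∀ xs ys (F : A → B → ℕ) → ∑[ x ∈ xs ] ∑[ y ∈ ys ] F x y ≡ ∑[ y ∈ ys ] ∑[ x ∈ xs ] F x y
∑-swap []       ys F = sym (∑-zero ys)
∑-swap (x ∷ xs) ys F = trans (cong (∑ ys (F x) +_) (∑-swap xs ys F)) (sym (∑-+ ys (F x) _))

𝟙 : {P : Set} → Dec P → ℕ
𝟙 p? = if does p? then 1 else 0

𝟙-yes : ∀ {P : Set} (p? : Dec P) → P → 𝟙 p? ≡ 1
𝟙-yes p? p rewrite dec-true p? p = refl

𝟙-no : ∀ {P : Set} (p? : Dec P) → ¬ P → 𝟙 p? ≡ 0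
𝟙-no p? ¬p rewrite dec-false p? ¬p = refl

*-𝟙-yes : ∀ m {P : Set} (p? : Dec P) → P → m * 𝟙 p? ≡ m
*-𝟙-yes m p? p = trans (cong (m *_) (𝟙-yes p? p)) (*-identityʳ m)

*-𝟙-no : ∀ m {P : Set} (p? : Dec P) → ¬ P → m * 𝟙 p? ≡ 0
*-𝟙-no m p? ¬p = trans (cong (m *_) (𝟙-no p? ¬p)) (*-zeroʳ m)

𝟙≤1 : ∀ {P : Set} (p? : Dec P) → 𝟙 p? ≤ 1
𝟙≤1 (yes _) = ≤-refl
𝟙≤1 (no _)  = z≤n

𝟙-cong : ∀ {P Q : Set} → P ⇔ Q → (p? : Dec P) (q? : Dec Q) → 𝟙 p? ≡ 𝟙 q?
𝟙-cong P⇔Q p? q? = cong (λ b → if b then 1 else 0) (does-⇔ P⇔Q p? q?)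

length-filter : ∀ {P : A → Set} (P? : Decidable P) xs →
  length (filter P? xs) ≡ ∑[ x ∈ xs ] 𝟙 (P? x)
length-filter P? []       = refl
length-filter P? (x ∷ xs) with does (P? x)
... | true  = cong suc (length-filter P? xs)
... | false = length-filter P? xs

-- Marked occurrences and binomial moments

firstMark : List Bool → Bool
firstMark []      = false
firstMark (s ∷ _) = s

-- S marks positions of w; positions beyond the end of S are unmarked.
Marked : (List ℕ → Set) → List Bool → List ℕ → Set
Marked P S []      = ⊤
Marked P S (x ∷ w) = (T (firstMark S) → P (x ∷ w)) × Marked P (drop 1 S) w

marked? : ∀ {P} → Decidable P → ∀ S → Decidable (Marked P S)
marked? P? S []      = yes tt
marked? P? S (x ∷ w) = (T? (firstMark S) →-dec P? (x ∷ w)) ×-dec marked? P? (drop 1 S) w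

Marked-map : ∀ {P Q : List ℕ → Set} → (∀ {v} → P v → Q v) → ∀ S w → Marked P S w → Marked Q S w
Marked-map f S []      _       = tt
Marked-map f S (x ∷ w) (p , m) = f ∘ p , Marked-map f (drop 1 S) w m

hits : ∀ {P : List ℕ → Set} → Decidable P → List ℕ → ℕ
hits P? []      = 0
hits P? (x ∷ w) = 𝟙 (P? (x ∷ w)) + hits P? w

hits≤length : ∀ {P} (P? : Decidable P) w → hits P? w ≤ length w
hits≤length P? []      = z≤n
hits≤length P? (x ∷ w) = +-mono-≤ (𝟙≤1 (P? (x ∷ w))) (hits≤length P? w)

markings : ℕ → List (List Bool)
markings zero    = [] ∷ []
markings (suc n) = map (true ∷_) (markings n) ++ map (false ∷_) (markings n)

∣_∣ : List Bool → ℕ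
∣ [] ∣        = 0
∣ true ∷ S ∣  = suc ∣ S ∣
∣ false ∷ S ∣ = ∣ S ∣

hits-choose : ∀ {P : List ℕ → Set} (P? : Decidable P) w m →
  hits P? w C m ≡ ∑[ S ∈ markings (length w) ] 𝟙 (∣ S ∣ ≟ m) * 𝟙 (marked? P? S w)
hits-choose P? []      zero    = refl
hits-choose P? []      (suc m) = refl
hits-choose P? (x ∷ w) m = begin
  (𝟙 (P? (x ∷ w)) + hits P? w) C m
    ≡⟨ pascal (P? (x ∷ w)) m ⟩
  (∑[ S ∈ Ms ] G (true ∷ S)) + (∑[ S ∈ Ms ] G (false ∷ S))
    ≡⟨ cong₂ _+_ (∑-map (true ∷_) Ms G) (∑-map (false ∷_) Ms G) ⟨
  ∑ (map (true ∷_) Ms) G + ∑ (map (false ∷_) Ms) G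
    ≡⟨ ∑-++ (map (true ∷_) Ms) _ G ⟨
  ∑ (markings (suc (length w))) G ∎
  where
  Ms = markings (length w)
  G : List Bool → ℕ
  G S = 𝟙 (∣ S ∣ ≟ m) * 𝟙 (marked? P? S (x ∷ w))
  choose-marked : ℕ → ℕ
  choose-marked m = ∑[ S ∈ Ms ] 𝟙 (∣ S ∣ ≟ m) * 𝟙 (marked? P? S w)
  pascal : ∀ {Q : Set} (p? : Dec Q) m →
    (𝟙 p? + hits P? w) C m ≡
    (∑[ S ∈ Ms ] 𝟙 (suc ∣ S ∣ ≟ m) * 𝟙 ((T? true →-dec p?) ×-dec marked? P? S w)) + choose-marked m
  pascal (yes _) zero    =
    trans (hits-choose P? w zero) (cong (_+ choose-marked zero) (sym (∑-zero Ms)))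
  pascal (yes _) (suc m) = begin
    suc (hits P? w) C suc m             ≡⟨ nCk+nC[k+1]≡[n+1]C[k+1] (hits P? w) m ⟨
    hits P? w C m + hits P? w C suc m   ≡⟨ cong₂ _+_ (hits-choose P? w m) (hits-choose P? w (suc m)) ⟩
    choose-marked m + choose-marked (suc m) ∎
  pascal (no _)  m       = begin
    hits P? w C m
      ≡⟨ hits-choose P? w m ⟩
    choose-marked m
      ≡⟨ cong (_+ choose-marked m) (trans (∑-cong Ms (λ {S} _ → *-zeroʳ (𝟙 (suc ∣ S ∣ ≟ m)))) (∑-zero Ms)) ⟨
    (∑[ S ∈ Ms ] 𝟙 (suc ∣ S ∣ ≟ m) * 0) + choose-marked m ∎

∑-hits-choose : ∀ {P : List ℕ → Set} (P? : Decidable P) {n} ws →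
  All (λ w → length w ≡ n) ws → ∀ m →
  ∑[ w ∈ ws ] hits P? w C m ≡ ∑[ S ∈ markings n ] 𝟙 (∣ S ∣ ≟ m) * (∑[ w ∈ ws ] 𝟙 (marked? P? S w))
∑-hits-choose P? {n} ws lengths m = begin
  ∑[ w ∈ ws ] hits P? w C m
    ≡⟨ ∑-cong ws (λ {w} w∈ws → trans (hits-choose P? w m)
         (cong (λ l → ∑[ S ∈ markings l ] 𝟙 (∣ S ∣ ≟ m) * 𝟙 (marked? P? S w)) (All.lookup lengths w∈ws))) ⟩
  ∑[ w ∈ ws ] ∑[ S ∈ markings n ] 𝟙 (∣ S ∣ ≟ m) * 𝟙 (marked? P? S w)
    ≡⟨ ∑-swap ws (markings n) _ ⟩
  ∑[ S ∈ markings n ] ∑[ w ∈ ws ] 𝟙 (∣ S ∣ ≟ m) * 𝟙 (marked? P? S w)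
    ≡⟨ ∑-cong (markings n) (λ {S} _ → ∑-*ˡ (𝟙 (∣ S ∣ ≟ m)) ws _) ⟩
  ∑[ S ∈ markings n ] 𝟙 (∣ S ∣ ≟ m) * (∑[ w ∈ ws ] 𝟙 (marked? P? S w)) ∎

∑-select-absent : ∀ (F : ℕ → ℕ) {x} N → N ≤ x → ∑[ r ∈ downFrom N ] F r * 𝟙 (x ≟ r) ≡ 0
∑-select-absent F     zero    _   = refl
∑-select-absent F {x} (suc N) N<x =
  cong₂ _+_ (*-𝟙-no (F N) (x ≟ N) (λ { refl → <-irrefl refl N<x })) (∑-select-absent F N (<⇒≤ N<x))

∑-select : ∀ (F : ℕ → ℕ) {x} N → x < N → ∑[ r ∈ downFrom N ] F r * 𝟙 (x ≟ r) ≡ F x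
∑-select F {x} (suc N) x<1+N with m≤n⇒m<n∨m≡n (s≤s⁻¹ x<1+N)
... | inj₁ x<N  =
  cong₂ _+_ (*-𝟙-no (F N) (x ≟ N) (λ { refl → <-irrefl refl x<N })) (∑-select F N x<N)
... | inj₂ refl =
  trans (cong₂ _+_ (*-𝟙-yes (F x) (x ≟ x) refl) (∑-select-absent F x ≤-refl)) (+-identityʳ (F x))

∑-regroup : ∀ (F : ℕ → ℕ) (v : A → ℕ) N xs → All (λ x → v x < N) xs →
  ∑[ x ∈ xs ] F (v x) ≡ ∑[ r ∈ downFrom N ] F r * (∑[ x ∈ xs ] 𝟙 (v x ≟ r))
∑-regroup F v N xs bounded = begin
  ∑[ x ∈ xs ] F (v x)
    ≡⟨ ∑-cong xs (λ x∈xs → ∑-select F N (All.lookup bounded x∈xs)) ⟨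
  ∑[ x ∈ xs ] ∑[ r ∈ downFrom N ] F r * 𝟙 (v x ≟ r)
    ≡⟨ ∑-swap xs (downFrom N) _ ⟩
  ∑[ r ∈ downFrom N ] ∑[ x ∈ xs ] F r * 𝟙 (v x ≟ r)
    ≡⟨ ∑-cong (downFrom N) (λ {r} _ → ∑-*ˡ (F r) xs _) ⟩
  ∑[ r ∈ downFrom N ] F r * (∑[ x ∈ xs ] 𝟙 (v x ≟ r)) ∎

∑-choose-below : ∀ (f : ℕ → ℕ) N m → N ≤ m → ∑[ r ∈ downFrom N ] (r C m) * f r ≡ 0
∑-choose-below f zero    m _   = refl
∑-choose-below f (suc N) m N<m rewrite k>n⇒nCk≡0 N<m = ∑-choose-below f N m (<⇒≤ N<m)

∑-choose-top : ∀ (f : ℕ → ℕ) N → ∑[ r ∈ downFrom (suc N) ] (r C N) * f r ≡ f N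
∑-choose-top f N rewrite nCn≡1 N | ∑-choose-below f N N ≤-refl =
  trans (+-identityʳ _) (+-identityʳ (f N))

binomial-inversion : ∀ N (f g : ℕ → ℕ) →
  (∀ m → ∑[ r ∈ downFrom N ] (r C m) * f r ≡ ∑[ r ∈ downFrom N ] (r C m) * g r) →
  ∀ {r} → r < N → f r ≡ g r
binomial-inversion (suc N) f g moments {r} r<1+N = case (m≤n⇒m<n∨m≡n (s≤s⁻¹ r<1+N))
  where
  top : f N ≡ g N
  top = trans (sym (∑-choose-top f N)) (trans (moments N) (∑-choose-top g N))
  lower : ∀ m → ∑[ r ∈ downFrom N ] (r C m) * f r ≡ ∑[ r ∈ downFrom N ] (r C m) * g r
  lower m =
    +-cancelˡ-≡ ((N C m) * g N) _ _ (trans (cong (λ y → (N C m) * y + _) (sym top)) (moments m))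
  case : r < N ⊎ r ≡ N → f r ≡ g r
  case (inj₁ r<N) = binomial-inversion N f g lower r<N
  case (inj₂ refl) = top

marked-counts⇒hit-counts : ∀ {P Q : List ℕ → Set} (P? : Decidable P) (Q? : Decidable Q) {n} ws →
  All (λ w → length w ≡ n) ws →
  (∀ S → ∑[ w ∈ ws ] 𝟙 (marked? P? S w) ≡ ∑[ w ∈ ws ] 𝟙 (marked? Q? S w)) →
  ∀ r → ∑[ w ∈ ws ] 𝟙 (hits P? w ≟ r) ≡ ∑[ w ∈ ws ] 𝟙 (hits Q? w ≟ r)
marked-counts⇒hit-counts P? Q? {n} ws lengths same r =
  binomial-inversion N (distribution P?) (distribution Q?) moments (s≤s (m≤n+m r n))
  where
  -- N bounds r as well as every hit count, which is at most n.
  N = suc (n + r)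
  distribution : ∀ {R : List ℕ → Set} → Decidable R → ℕ → ℕ
  distribution R? j = ∑[ w ∈ ws ] 𝟙 (hits R? w ≟ j)
  bounded : ∀ {R : List ℕ → Set} (R? : Decidable R) → All (λ w → hits R? w < N) ws
  bounded R? = All.map (λ {w} len → s≤s (≤-trans (hits≤length R? w) (≤-trans (≤-reflexive len) (m≤m+n n r))))
                       lengths
  moment : ∀ {R : List ℕ → Set} (R? : Decidable R) m →
    ∑[ j ∈ downFrom N ] (j C m) * distribution R? j ≡
    ∑[ S ∈ markings n ] 𝟙 (∣ S ∣ ≟ m) * (∑[ w ∈ ws ] 𝟙 (marked? R? S w))
  moment R? m = trans (sym (∑-regroup (_C m) (hits R?) N ws (bounded R?))) (∑-hits-choose R? ws lengths m)
  moments : ∀ m →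
    ∑[ j ∈ downFrom N ] (j C m) * distribution P? j ≡ ∑[ j ∈ downFrom N ] (j C m) * distribution Q? j
  moments m = trans (moment P? m)
    (trans (∑-cong (markings n) (λ {S} _ → cong (𝟙 (∣ S ∣ ≟ m) *_) (same S))) (sym (moment Q? m)))

∑-words-suc : ∀ k n (h : List ℕ → ℕ) →
  ∑ (words k (suc n)) h ≡ ∑[ a ∈ letters k ] ∑[ w ∈ words k n ] h (a ∷ w)
∑-words-suc k n h =
  trans (∑-concatMap _ (letters k) h) (∑-cong (letters k) λ {a} _ → ∑-map (a ∷_) (words k n) h)

words-length : ∀ k n → All (λ w → length w ≡ n) (words k n)
words-length k zero    = refl ∷ []
words-length k (suc n) =
  concat⁺ (map⁺ (All.universal (λ a → map⁺ (All.map (cong suc) (words-length k n))) (letters k)))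

letters-unique : ∀ k → Unique (letters k)
letters-unique k = Unique.map⁺ suc-injective (Unique.upTo⁺ k)

1∈letters : ∀ {k} → k ≥ 1 → 1 ∈ letters k
1∈letters {suc k} _ = here refl

∑-𝟙-≟-absent : ∀ {p} {L : List ℕ} → All (p ≢_) L → ∑[ a ∈ L ] 𝟙 (a ≟ p) ≡ 0
∑-𝟙-≟-absent                 []          = refl
∑-𝟙-≟-absent {p} {L = a ∷ _} (p≢a ∷ p∉L) =
  cong₂ _+_ (𝟙-no (a ≟ p) (p≢a ∘ sym)) (∑-𝟙-≟-absent p∉L)

∑-𝟙-≟-unique : ∀ {p} {L : List ℕ} → Unique L → p ∈ L → ∑[ a ∈ L ] 𝟙 (a ≟ p) ≡ 1
∑-𝟙-≟-unique {p}             (a∉L ∷ _)  (here refl) =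
  cong₂ _+_ (𝟙-yes (p ≟ p) refl) (∑-𝟙-≟-absent a∉L)
∑-𝟙-≟-unique {p} {L = a ∷ _} (a∉L ∷ uL) (there p∈L) =
  cong₂ _+_ (𝟙-no (a ≟ p) (All.lookup a∉L p∈L)) (∑-𝟙-≟-unique uL p∈L)

transpose : ℕ → ℕ → ℕ → ℕ
transpose p q x with x ≟ p | x ≟ q
... | yes _ | _     = q
... | no _  | yes _ = p
... | no _  | no _  = x

transpose-p : ∀ p q → transpose p q p ≡ q
transpose-p p q with p ≟ p | p ≟ q
... | yes _  | _ = refl
... | no p≢p | _ = ⊥-elim (p≢p refl)

transpose-q : ∀ p q → transpose p q q ≡ p
transpose-q p q with q ≟ p | q ≟ q
... | yes q≡p | _      = q≡p
... | no _    | yes _  = refl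
... | no _    | no q≢q = ⊥-elim (q≢q refl)

transpose-other : ∀ {p q x} → x ≢ p → x ≢ q → transpose p q x ≡ x
transpose-other {p} {q} {x} x≢p x≢q with x ≟ p | x ≟ q
... | yes x≡p | _       = ⊥-elim (x≢p x≡p)
... | no _    | yes x≡q = ⊥-elim (x≢q x≡q)
... | no _    | no _    = refl

transpose≡q⇒≡p : ∀ {p q x} → transpose p q x ≡ q → x ≡ p
transpose≡q⇒≡p {p} {q} {x} eq with x ≟ p | x ≟ q
... | yes x≡p | _       = x≡p
... | no _    | yes x≡q = trans x≡q (sym eq)
... | no _    | no x≢q  = ⊥-elim (x≢q eq)

transpose-balance : ∀ (F : ℕ → ℕ) p q a (a≟p : Dec (a ≡ p)) (a≟q : Dec (a ≡ q)) →
  F (transpose p q a) + (𝟙 a≟p * F p + 𝟙 a≟q * F q) ≡ F a + (𝟙 a≟p * F q + 𝟙 a≟q * F p)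
transpose-balance F p q a (yes refl) (yes refl) rewrite transpose-p a a = refl
transpose-balance F p q a (yes refl) (no _)     rewrite transpose-p a q = exchange (F q) (F a)
  where
  exchange : ∀ x y → x + (1 * y + 0 * x) ≡ y + (1 * x + 0 * y)
  exchange = solve-∀
transpose-balance F p q a (no _)     (yes refl) rewrite transpose-q p a = exchange (F p) (F a)
  where
  exchange : ∀ x y → x + (0 * x + 1 * y) ≡ y + (0 * y + 1 * x)
  exchange = solve-∀
transpose-balance F p q a (no a≢p)   (no a≢q)   = cong (λ b → F b + 0) (transpose-other a≢p a≢q)

∑-transpose : ∀ {L p q} → Unique L → p ∈ L → q ∈ L → (F : ℕ → ℕ) →
  ∑[ a ∈ L ] F (transpose p q a) ≡ ∑ L F
∑-transpose {L} {p} {q} uL p∈L q∈L F = +-cancelʳ-≡ (F p + F q) _ _ (begin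
  ∑ L (F ∘ transpose p q) + (F p + F q)
    ≡⟨ cong (∑ L (F ∘ transpose p q) +_) (cong₂ _+_ (weighted p∈L (F p)) (weighted q∈L (F q)))
     ⟨
  ∑ L (F ∘ transpose p q) + ((∑[ a ∈ L ] 𝟙 (a ≟ p) * F p) + (∑[ a ∈ L ] 𝟙 (a ≟ q) * F q))
    ≡⟨ split (F ∘ transpose p q) _ _ ⟨
  ∑[ a ∈ L ] (F (transpose p q a) + (𝟙 (a ≟ p) * F p + 𝟙 (a ≟ q) * F q))
    ≡⟨ ∑-cong L (λ {a} _ → transpose-balance F p q a (a ≟ p) (a ≟ q)) ⟩
  ∑[ a ∈ L ] (F a + (𝟙 (a ≟ p) * F q + 𝟙 (a ≟ q) * F p))
    ≡⟨ split F _ _ ⟩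
  ∑ L F + ((∑[ a ∈ L ] 𝟙 (a ≟ p) * F q) + (∑[ a ∈ L ] 𝟙 (a ≟ q) * F p))
    ≡⟨ cong (∑ L F +_) (cong₂ _+_ (weighted p∈L (F q)) (weighted q∈L (F p))) ⟩
  ∑ L F + (F q + F p)
    ≡⟨ cong (∑ L F +_) (+-comm (F q) (F p)) ⟩
  ∑ L F + (F p + F q) ∎)
  where
  weighted : ∀ {c} → c ∈ L → ∀ m → ∑[ a ∈ L ] 𝟙 (a ≟ c) * m ≡ m
  weighted c∈L m = trans (∑-*ʳ m L _) (trans (cong (_* m) (∑-𝟙-≟-unique uL c∈L)) (*-identityˡ m))
  split : ∀ (f g h : ℕ → ℕ) → ∑[ a ∈ L ] (f a + (g a + h a)) ≡ ∑ L f + (∑ L g + ∑ L h)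
  split f g h = trans (∑-+ L f _) (cong (∑ L f +_) (∑-+ L g h))

τ1213 τ1223 : List ℕ
τ1213 = 1 ∷ 2 ∷ 1 ∷ 3 ∷ []
τ1223 = 1 ∷ 2 ∷ 2 ∷ 3 ∷ []

Starts1213 Starts1223 : List ℕ → Set
Starts1213 (a ∷ b ∷ c ∷ d ∷ _) = a < b × c ≡ a × b < d
Starts1213 _                   = ⊥
Starts1223 (a ∷ b ∷ c ∷ d ∷ _) = a < b × b ≡ c × b < d
Starts1223 _                   = ⊥

1213-nonoverlapping : ∀ {x} w → Starts1213 (x ∷ w) → ¬ Starts1213 w
1213-nonoverlapping (_ ∷ _ ∷ _ ∷ _ ∷ _) (x<a , refl , _) (a<x , _ , _) = <-asym x<a a<x

1223-nonoverlapping : ∀ {x} w → Starts1223 (x ∷ w) → ¬ Starts1223 w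
1223-nonoverlapping (_ ∷ _ ∷ _ ∷ _ ∷ _) (_ , refl , _) (a<a , _ , _) = <-irrefl refl a<a

Occurs : List ℕ → List ℕ → Set
Occurs τ v = orderIso (take (length τ) v) τ ≡ true

occurs? : ∀ τ → Decidable (Occurs τ)
occurs? τ v = orderIso (take (length τ) v) τ Bool.≟ true

cmp-< : ∀ {a b} → a < b → cmp a b ≡ LT
cmp-< {a} {b} a<b with <-cmp a b
... | tri< _ _ _   = refl
... | tri≈ _ a≡b _ = ⊥-elim (<-irrefl a≡b a<b)
... | tri> _ _ b<a = ⊥-elim (<-asym a<b b<a)

cmp-> : ∀ {a b} → b < a → cmp a b ≡ GT
cmp-> {a} {b} b<a with <-cmp a b
... | tri< a<b _ _ = ⊥-elim (<-asym a<b b<a)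
... | tri≈ _ a≡b _ = ⊥-elim (<-irrefl (sym a≡b) b<a)
... | tri> _ _ _   = refl

cmp-refl : ∀ a → cmp a a ≡ EQ
cmp-refl a with <-cmp a a
... | tri< a<a _ _ = ⊥-elim (<-irrefl refl a<a)
... | tri≈ _ _ _   = refl
... | tri> _ _ a<a = ⊥-elim (<-irrefl refl a<a)

cmp≡LT⇒< : ∀ {a b} → cmp a b ≡ LT → a < b
cmp≡LT⇒< {a} {b} _ with <-cmp a b
... | tri< a<b _ _ = a<b

cmp≡EQ⇒≡ : ∀ {a b} → cmp a b ≡ EQ → a ≡ b
cmp≡EQ⇒≡ {a} {b} _ with <-cmp a b
... | tri≈ _ a≡b _ = a≡b

cmp-eq⇒≡ : ∀ {c d} → cmp-eq c d ≡ true → c ≡ d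
cmp-eq⇒≡ {LT} {LT} _ = refl
cmp-eq⇒≡ {EQ} {EQ} _ = refl
cmp-eq⇒≡ {GT} {GT} _ = refl

and-true : ∀ bs → and bs ≡ true → All (_≡ true) bs
and-true []           _  = []
and-true (true ∷ bs)  eq = refl ∷ and-true bs eq

-- The table of comparisons conjoined by orderIso, restated so that it can be named.
comparisons : List ℕ → List ℕ → List Bool
comparisons u v =
  concatMap (λ i → map (λ j → cmp-eq (cmp (at u i) (at u j)) (cmp (at v i) (at v j))) (upTo (length u)))
            (upTo (length u))
  where
  at : List ℕ → ℕ → ℕ
  at []       _       = 0
  at (x ∷ xs) zero    = x
  at (x ∷ xs) (suc i) = at xs i

occurs1213⇒starts1213 : ∀ {v} → Occurs τ1213 v → Starts1213 v
occurs1213⇒starts1213 {a ∷ b ∷ c ∷ d ∷ _} occ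
  with and-true (comparisons (a ∷ b ∷ c ∷ d ∷ []) τ1213) occ
... | _ ∷ ab ∷ _ ∷ _ ∷ _ ∷ _ ∷ _ ∷ bd ∷ ca ∷ _ =
  cmp≡LT⇒< (cmp-eq⇒≡ ab) , cmp≡EQ⇒≡ (cmp-eq⇒≡ ca) , cmp≡LT⇒< (cmp-eq⇒≡ bd)

occurs1223⇒starts1223 : ∀ {v} → Occurs τ1223 v → Starts1223 v
occurs1223⇒starts1223 {a ∷ b ∷ c ∷ d ∷ _} occ
  with and-true (comparisons (a ∷ b ∷ c ∷ d ∷ []) τ1223) occ
... | _ ∷ ab ∷ _ ∷ _ ∷ _ ∷ _ ∷ bc ∷ bd ∷ _ =
  cmp≡LT⇒< (cmp-eq⇒≡ ab) , cmp≡EQ⇒≡ (cmp-eq⇒≡ bc) , cmp≡LT⇒< (cmp-eq⇒≡ bd)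

starts1213⇒occurs1213 : ∀ {v} → Starts1213 v → Occurs τ1213 v
starts1213⇒occurs1213 {a ∷ b ∷ _ ∷ d ∷ _} (a<b , refl , b<d)
  rewrite cmp-refl a | cmp-refl b | cmp-refl d | cmp-< a<b | cmp-< b<d | cmp-< (<-trans a<b b<d)
        | cmp-> a<b | cmp-> b<d | cmp-> (<-trans a<b b<d) = refl

starts1223⇒occurs1223 : ∀ {v} → Starts1223 v → Occurs τ1223 v
starts1223⇒occurs1223 {a ∷ b ∷ _ ∷ d ∷ _} (a<b , refl , b<d)
  rewrite cmp-refl a | cmp-refl b | cmp-refl d | cmp-< a<b | cmp-< b<d | cmp-< (<-trans a<b b<d)
        | cmp-> a<b | cmp-> b<d | cmp-> (<-trans a<b b<d) = refl

-- The relabelling bijection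

transposeIf : Bool → ℕ → ℕ → ℕ → ℕ
transposeIf true  p q x = transpose p q x
transposeIf false p q x = x

transposeIf-unmarked : ∀ {s p q x} → ¬ T s → transposeIf s p q x ≡ x
transposeIf-unmarked {true}  ¬t = ⊥-elim (¬t tt)
transposeIf-unmarked {false} _  = refl

-- w is preceded by the original letters p and q, which carry the marks s₂ and s₁.
relabel : Bool → ℕ → Bool → ℕ → List Bool → List ℕ → List ℕ
relabel s₂ p s₁ q S []      = []
relabel s₂ p s₁ q S (x ∷ w) = transposeIf s₂ p q x ∷ relabel s₁ q (firstMark S) x (drop 1 S) w

∑-relabel : ∀ {k} n {s₂ p s₁ q} S → p ∈ letters k → q ∈ letters k → (h : List ℕ → ℕ) →
  ∑[ w ∈ words k n ] h (relabel s₂ p s₁ q S w) ≡ ∑ (words k n) h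
∑-relabel zero _ _ _ _ = refl
∑-relabel {k} (suc n) {s₂} {p} {s₁} {q} S p∈ q∈ h = begin
  ∑[ w ∈ words k (suc n) ] h (relabel s₂ p s₁ q S w)
    ≡⟨ ∑-words-suc k n _ ⟩
  ∑[ a ∈ letters k ] ∑[ w ∈ words k n ] h (transposeIf s₂ p q a ∷ relabel s₁ q (firstMark S) a (drop 1 S) w)
    ≡⟨ ∑-cong (letters k) (λ {a} a∈ → ∑-relabel n (drop 1 S) q∈ a∈ (h ∘ (transposeIf s₂ p q a ∷_))) ⟩
  ∑[ a ∈ letters k ] ∑[ w ∈ words k n ] h (transposeIf s₂ p q a ∷ w)
    ≡⟨ permute s₂ ⟩
  ∑[ a ∈ letters k ] ∑[ w ∈ words k n ] h (a ∷ w)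
    ≡⟨ ∑-words-suc k n h ⟨
  ∑ (words k (suc n)) h ∎
  where
  permute : ∀ s → ∑[ a ∈ letters k ] ∑[ w ∈ words k n ] h (transposeIf s p q a ∷ w) ≡
                  ∑[ a ∈ letters k ] ∑[ w ∈ words k n ] h (a ∷ w)
  permute true  = ∑-transpose (letters-unique k) p∈ q∈ (λ b → ∑[ w ∈ words k n ] h (b ∷ w))
  permute false = refl

lookbehind-< : ∀ {s₂ p q x y} w → (T s₂ → Starts1213 (p ∷ q ∷ x ∷ y ∷ w)) →
  transposeIf s₂ p q x < y ⇔ x < y
lookbehind-< {false} _ _ = mk⇔ id id
lookbehind-< {true} {p} {q} _ lb with lb tt
... | p<q , refl , q<y = mk⇔ (λ _ → <-trans p<q q<y) (λ _ → subst (_< _) (sym (transpose-p p q)) q<y)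

relabel-head-1213→1223 : ∀ {s₂ p s₁ q x} s S w →
  (T s₂ → Starts1213 (p ∷ q ∷ x ∷ w)) → (T s₁ → Starts1213 (q ∷ x ∷ w)) →
  Starts1213 (x ∷ w) → Marked Starts1213 S w → T s →
  Starts1223 (transposeIf s₂ p q x ∷ relabel s₁ q s x S w)
relabel-head-1213→1223 {s₁ = true} _ _ w _ lb₁ a _ _ = ⊥-elim (1213-nonoverlapping (_ ∷ w) (lb₁ tt) a)
relabel-head-1213→1223 {s₁ = false} {x = x} true _ (y ∷ _ ∷ d ∷ r) lb₂ _ a@(x<y , refl , y<d)
                       (lookahead , _) _ =
  Equivalence.from (lookbehind-< (x ∷ d ∷ r) lb₂) x<y ,
  sym (transpose-p x y) ,
  subst (y <_) (sym (transposeIf-unmarked λ t → 1213-nonoverlapping (y ∷ x ∷ d ∷ r) a (lookahead t))) y<d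

relabel-head-1223→1213 : ∀ {s₂ p s₁ q x} s S w →
  (T s₂ → Starts1213 (p ∷ q ∷ x ∷ w)) → (T s₁ → Starts1213 (q ∷ x ∷ w)) →
  Starts1223 (transposeIf s₂ p q x ∷ relabel s₁ q s x S w) →
  Marked Starts1223 S (relabel s₁ q s x S w) → T s →
  Starts1213 (x ∷ w)
relabel-head-1223→1213 {s₂} {p} {true} {q} {x} true _ (y ∷ z ∷ d ∷ r) lb₂ lb₁ (lt , _) _ _
  with lb₁ tt
... | q<x , refl , _ = ⊥-elim (<-irrefl refl (subst₂ _<_ unchanged (transpose-p q x) lt))
  where
  unchanged : transposeIf s₂ p q x ≡ x
  unchanged = transposeIf-unmarked λ t → 1213-nonoverlapping (q ∷ x ∷ y ∷ z ∷ d ∷ r) (lb₂ t) (lb₁ tt)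
relabel-head-1223→1213 {s₁ = false} {x = x} true _ (y ∷ z ∷ d ∷ r) lb₂ _ b@(lt , eq , lt′)
                       (lookahead , _) _ =
  Equivalence.to (lookbehind-< (z ∷ d ∷ r) lb₂) lt ,
  transpose≡q⇒≡p (sym eq) ,
  subst (y <_) (transposeIf-unmarked λ t → 1223-nonoverlapping _ b (lookahead t)) lt′

relabel-1213→1223 : ∀ {s₂ p s₁ q} S w → (T s₂ → Starts1213 (p ∷ q ∷ w)) → (T s₁ → Starts1213 (q ∷ w)) →
  Marked Starts1213 S w → Marked Starts1223 S (relabel s₂ p s₁ q S w)
relabel-1213→1223 S []      _   _   _       = tt
relabel-1213→1223 S (x ∷ w) lb₂ lb₁ (a , m) =
  (λ t → relabel-head-1213→1223 (firstMark S) (drop 1 S) w lb₂ lb₁ (a t) m t) ,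
  relabel-1213→1223 (drop 1 S) w lb₁ a m

relabel-1223→1213 : ∀ {s₂ p s₁ q} S w → (T s₂ → Starts1213 (p ∷ q ∷ w)) → (T s₁ → Starts1213 (q ∷ w)) →
  Marked Starts1223 S (relabel s₂ p s₁ q S w) → Marked Starts1213 S w
relabel-1223→1213 S []      _   _   _       = tt
relabel-1223→1213 S (x ∷ w) lb₂ lb₁ (b , m) = a , relabel-1223→1213 (drop 1 S) w lb₁ a m
  where
  a : T (firstMark S) → Starts1213 (x ∷ w)
  a t = relabel-head-1223→1213 (firstMark S) (drop 1 S) w lb₂ lb₁ (b t) m t

-- The padding letters are unmarked, so their value is irrelevant, except that ∑-relabel
-- needs them in [k]; this is where k ≥ 1 is used.
marked-counts-agree : ∀ {k} → k ≥ 1 → ∀ n S →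
  ∑[ w ∈ words k n ] 𝟙 (marked? (occurs? τ1213) S w) ≡ ∑[ w ∈ words k n ] 𝟙 (marked? (occurs? τ1223) S w)
marked-counts-agree {k} k≥1 n S = begin
  ∑[ w ∈ words k n ] 𝟙 (marked? (occurs? τ1213) S w)
    ≡⟨ ∑-cong (words k n) (λ {w} _ →
         𝟙-cong (relabel-correct w) (marked? (occurs? τ1213) S w) (marked? (occurs? τ1223) S _)) ⟩
  ∑[ w ∈ words k n ] 𝟙 (marked? (occurs? τ1223) S (relabel false 1 false 1 S w))
    ≡⟨ ∑-relabel n S (1∈letters k≥1) (1∈letters k≥1) (λ w → 𝟙 (marked? (occurs? τ1223) S w)) ⟩
  ∑[ w ∈ words k n ] 𝟙 (marked? (occurs? τ1223) S w) ∎
  where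
  relabel-correct : ∀ w → Marked (Occurs τ1213) S w ⇔ Marked (Occurs τ1223) S (relabel false 1 false 1 S w)
  relabel-correct w = mk⇔
    (Marked-map starts1223⇒occurs1223 S _ ∘ relabel-1213→1223 S w (λ ()) (λ ()) ∘
     Marked-map occurs1213⇒starts1213 S w)
    (Marked-map starts1213⇒occurs1213 S w ∘ relabel-1223→1213 S w (λ ()) (λ ()) ∘
     Marked-map occurs1223⇒starts1223 S _)

hits-via-drop : ∀ {P : List ℕ → Set} (P? : Decidable P) σ →
  ∑[ i ∈ upTo (length σ) ] 𝟙 (P? (drop i σ)) ≡ hits P? σ
hits-via-drop P? []      = refl
hits-via-drop P? (x ∷ σ) = cong (𝟙 (P? (x ∷ σ)) +_) (begin
  ∑[ i ∈ applyUpTo suc (length σ) ] 𝟙 (P? (drop i (x ∷ σ)))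
    ≡⟨ cong (λ is → ∑[ i ∈ is ] 𝟙 (P? (drop i (x ∷ σ)))) (map-applyUpTo id suc (length σ)) ⟨
  ∑[ i ∈ map suc (upTo (length σ)) ] 𝟙 (P? (drop i (x ∷ σ)))
    ≡⟨ ∑-map suc (upTo (length σ)) _ ⟩
  ∑[ i ∈ upTo (length σ) ] 𝟙 (P? (drop i σ))
    ≡⟨ hits-via-drop P? σ ⟩
  hits P? σ ∎)

countExactly≡∑ : ∀ τ k n r → countExactly τ k n r ≡ ∑[ σ ∈ words k n ] 𝟙 (hits (occurs? τ) σ ≟ r)
countExactly≡∑ τ k n r = trans (length-filter _ (words k n)) (∑-cong (words k n) λ {σ} _ →
  cong (λ o → 𝟙 (o ≟ r)) (trans (length-filter _ (upTo (length σ))) (hits-via-drop (occurs? τ) σ)))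

corollary4p7 : (k n r : ℕ) → k ≥ 1 →
    countExactly (1 ∷ 2 ∷ 1 ∷ 3 ∷ []) k n r ≡ countExactly (1 ∷ 2 ∷ 2 ∷ 3 ∷ []) k n r
corollary4p7 k n r k≥1 = begin
  countExactly τ1213 k n r
    ≡⟨ countExactly≡∑ τ1213 k n r ⟩
  ∑[ σ ∈ words k n ] 𝟙 (hits (occurs? τ1213) σ ≟ r)
    ≡⟨ marked-counts⇒hit-counts (occurs? τ1213) (occurs? τ1223) (words k n) (words-length k n)
                                (marked-counts-agree k≥1 n) r ⟩
  ∑[ σ ∈ words k n ] 𝟙 (hits (occurs? τ1223) σ ≟ r)
    ≡⟨ countExactly≡∑ τ1223 k n r ⟨
  countExactly τ1223 k n r ∎
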